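{- Let $\mathcal{M}$ be a minor-closed class of graphs. Let $G\in\mathcal{M}$ and let $B\subseteq V(G)$ be an $\mathcal{M}$-boundary of $G$. Let $v\in B$. Then $C:=(B\setminus\{v\})\cup N_G(v)$ is an $\mathcal{M}$-boundary of $H:=G-v$.
   Context: All graphs are finite, simple and undirected. A class $\mathcal{M}$ of graphs is minor-closed if every minor of a graph in $\mathcal{M}$ is also in $\mathcal{M}$. For a graph $G\in\mathcal{M}$ and $B\subseteq V(G)$, let $G^{+B}$ denote the graph obtained from $G$ by adding a new vertex $\alpha$ adjacent to each vertex of $B$ (and to no other vertex). Then $B$ is called an $\mathcal{M}$-boundary of $G$ if $G^{+B}\in\mathcal{M}$. $N_G(v)$ denotes the set of neighbours of $v$ in $G$. -}

module Defs where

open import Data.Nat using (ℕ; suc)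
open import Data.Fin using (Fin; zero; suc; punchIn)
open import Data.Bool using (Bool; true; false; _∨_)
open import Data.Maybe using (Maybe; just)
open import Data.Product using (Σ; ∃; _×_; _,_)
open import Relation.Binary.PropositionalEquality using (_≡_; refl)

record Graph : Set where
  field
    n      : ℕ
    adj    : Fin n → Fin n → Bool
    sym    : ∀ x y → adj x y ≡ adj y x
    irrefl : ∀ x → adj x x ≡ false
open Graph public

VSet : Graph → Set
VSet G = Fin (n G) → Bool

data WalkIn (G : Graph) (P : Fin (n G) → Set) : Fin (n G) → Fin (n G) → Set where
  here : ∀ {x} → P x → WalkIn G P x x
  step : ∀ {x y z} → P x → adj G x y ≡ true → WalkIn G P y z → WalkIn G P x z

-- H is a minor of G: there is a model of H in G, i.e. a family of pairwise
-- disjoint (encoded by the partial map φ : V(G) → V(H)), nonempty, connected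
-- branch sets, such that adjacent vertices of H have adjacent branch sets.
record MinorModel (H G : Graph) : Set where
  field
    φ         : Fin (n G) → Maybe (Fin (n H))
    nonempty  : ∀ h → ∃ λ g → φ g ≡ just h
    connected : ∀ h g g' → φ g ≡ just h → φ g' ≡ just h →
                WalkIn G (λ x → φ x ≡ just h) g g'
    edges     : ∀ h h' → adj H h h' ≡ true →
                Σ (Fin (n G)) λ g → Σ (Fin (n G)) λ g' →
                  (φ g ≡ just h) × (φ g' ≡ just h') × (adj G g g' ≡ true)

_≼_ : Graph → Graph → Set
H ≼ G = MinorModel H G

MinorClosed : (Graph → Set) → Set
MinorClosed M = ∀ G H → M G → H ≼ G → M H

-- G^{+B}: the new vertex α is zero; old vertex x becomes suc x.
plusAdj : (G : Graph) → VSet G → Fin (suc (n G)) → Fin (suc (n G)) → Bool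
plusAdj G B zero    zero    = false
plusAdj G B zero    (suc y) = B y
plusAdj G B (suc x) zero    = B x
plusAdj G B (suc x) (suc y) = adj G x y

plusSym : (G : Graph) (B : VSet G) → ∀ x y → plusAdj G B x y ≡ plusAdj G B y x
plusSym G B zero    zero    = refl
plusSym G B zero    (suc y) = refl
plusSym G B (suc x) zero    = refl
plusSym G B (suc x) (suc y) = sym G x y

plusIrr : (G : Graph) (B : VSet G) → ∀ x → plusAdj G B x x ≡ false
plusIrr G B zero    = refl
plusIrr G B (suc x) = irrefl G x

_⁺_ : (G : Graph) → VSet G → Graph
G ⁺ B = record { n = suc (n G) ; adj = plusAdj G B ; sym = plusSym G B ; irrefl = plusIrr G B }

IsBoundary : (Graph → Set) → (G : Graph) → VSet G → Set
IsBoundary M G B = M (G ⁺ B)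

-- G - v, for a graph on Fin (suc m): vertex i of G - v is punchIn v i in G.
deleteVertex : (G : Graph) (m : ℕ) → n G ≡ suc m → Fin (n G) → Graph
deleteVertex G m refl v = record
  { n = m
  ; adj = λ i j → adj G (punchIn v i) (punchIn v j)
  ; sym = λ i j → sym G (punchIn v i) (punchIn v j)
  ; irrefl = λ i → irrefl G (punchIn v i) }

boundaryAfterDelete : (G : Graph) (m : ℕ) (e : n G ≡ suc m) (B : VSet G) (v : Fin (n G)) →
                      VSet (deleteVertex G m e v)
boundaryAfterDelete G m refl B v i = B (punchIn v i) ∨ adj G v (punchIn v i)

-- Since v ∈ B, the apex α of G⁺ᴮ is adjacent to v. Contracting the edge αv
-- deletes v and leaves a new apex adjacent to (B ∖ {v}) ∪ N_G(v), i.e. the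
-- contraction is (G − v)⁺ᶜ. So it is a minor of G⁺ᴮ ∈ M, and lies in M.
module Submission where

open import Defs
open import Data.Nat using (ℕ; suc)
open import Data.Fin using (Fin; zero; suc; punchIn; punchOut; _≟_)
open import Data.Fin.Properties using (punchIn-punchOut; punchIn-injective; punchInᵢ≢i)
open import Data.Bool using (Bool; true; false)
open import Data.Maybe using (just)
open import Data.Maybe.Properties using (just-injective)
open import Data.Product using (∃; _×_; _,_)
open import Data.Sum using (_⊎_; inj₁; inj₂)
open import Data.Empty using (⊥-elim)
open import Relation.Nullary using (yes; no)
open import Relation.Binary.PropositionalEquality
  using (_≡_; refl; trans; cong) renaming (sym to ≡-sym)

module ApexEdgeContraction
  (m : ℕ) (adjacent : Fin (suc m) → Fin (suc m) → Bool)
  (adjacent-sym : ∀ x y → adjacent x y ≡ adjacent y x)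
  (adjacent-irrefl : ∀ x → adjacent x x ≡ false)
  (B : Fin (suc m) → Bool) (v : Fin (suc m)) where

  G : Graph
  G = record { n = suc m ; adj = adjacent ; sym = adjacent-sym ; irrefl = adjacent-irrefl }

  H : Graph
  H = deleteVertex G m refl v ⁺ boundaryAfterDelete G m refl B v

  -- The branch set of the apex of H is {α, v}; every other branch set is a
  -- single vertex of G − v.
  contract : Fin (n (G ⁺ B)) → Fin (n H)
  contract zero = zero
  contract (suc x) with v ≟ x
  ... | yes _ = zero
  ... | no v≢x = suc (punchOut v≢x)

  contract-v : contract (suc v) ≡ zero
  contract-v with v ≟ v
  ... | yes _ = refl
  ... | no v≢v = ⊥-elim (v≢v refl)

  contract-punchIn : ∀ j → contract (suc (punchIn v j)) ≡ suc j
  contract-punchIn j with v ≟ punchIn v j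
  ... | yes v≡ = ⊥-elim (punchInᵢ≢i v j (≡-sym v≡))
  ... | no v≢ = cong suc (punchIn-injective v _ _ (punchIn-punchOut v≢))

  contract⁻¹-zero : ∀ g → contract g ≡ zero → g ≡ zero ⊎ g ≡ suc v
  contract⁻¹-zero zero _ = inj₁ refl
  contract⁻¹-zero (suc x) _ with v ≟ x
  contract⁻¹-zero (suc x) _  | yes refl = inj₂ refl
  contract⁻¹-zero (suc x) () | no _

  contract⁻¹-suc : ∀ g j → contract g ≡ suc j → g ≡ suc (punchIn v j)
  contract⁻¹-suc zero j ()
  contract⁻¹-suc (suc x) j eq with v ≟ x
  contract⁻¹-suc (suc x) j () | yes _
  contract⁻¹-suc (suc x) j refl | no v≢x = cong suc (≡-sym (punchIn-punchOut v≢x))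

  InBranch : Fin (n H) → Fin (n (G ⁺ B)) → Set
  InBranch h g = just (contract g) ≡ just h

  module _ (v∈B : B v ≡ true) where

    apex-branch-connected : ∀ g g' → contract g ≡ zero → contract g' ≡ zero →
                            WalkIn (G ⁺ B) (InBranch zero) g g'
    apex-branch-connected g g' g∈ g'∈ with contract⁻¹-zero g g∈ | contract⁻¹-zero g' g'∈
    ... | inj₁ refl | inj₁ refl = here refl
    ... | inj₁ refl | inj₂ refl = step refl v∈B (here (cong just contract-v))
    ... | inj₂ refl | inj₁ refl = step (cong just contract-v) v∈B (here refl)
    ... | inj₂ refl | inj₂ refl = here (cong just contract-v)

    branch-connected : ∀ h g g' → InBranch h g → InBranch h g' →
                       WalkIn (G ⁺ B) (InBranch h) g g'
    branch-connected zero g g' g∈ g'∈ =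
      apex-branch-connected g g' (just-injective g∈) (just-injective g'∈)
    branch-connected (suc j) g g' g∈ g'∈
      with contract⁻¹-suc g j (just-injective g∈) | contract⁻¹-suc g' j (just-injective g'∈)
    ... | refl | refl = here g∈

  branch-nonempty : ∀ h → ∃ λ g → InBranch h g
  branch-nonempty zero = zero , refl
  branch-nonempty (suc j) = suc (punchIn v j) , cong just (contract-punchIn j)

  -- An edge from the apex of H to j comes either from α (if j ∈ B) or,
  -- failing that, from v (then j ∈ N_G(v)).
  branch-edges : ∀ h h' → adj H h h' ≡ true →
                 ∃ λ g → ∃ λ g' → InBranch h g × InBranch h' g' × adj (G ⁺ B) g g' ≡ true
  branch-edges zero zero ()
  branch-edges zero (suc j) hh' with B (punchIn v j) in j∈B
  ... | true  = zero , suc (punchIn v j) , refl , cong just (contract-punchIn j) , j∈B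
  ... | false = suc v , suc (punchIn v j) , cong just contract-v , cong just (contract-punchIn j) , hh'
  branch-edges (suc j) zero hh' with B (punchIn v j) in j∈B
  ... | true  = suc (punchIn v j) , zero , cong just (contract-punchIn j) , refl , j∈B
  ... | false = suc (punchIn v j) , suc v , cong just (contract-punchIn j) , cong just contract-v ,
                trans (adjacent-sym _ _) hh'
  branch-edges (suc i) (suc j) hh' =
    suc (punchIn v i) , suc (punchIn v j) ,
    cong just (contract-punchIn i) , cong just (contract-punchIn j) , hh'

  minor : B v ≡ true → H ≼ (G ⁺ B)
  minor v∈B = record
    { φ = λ g → just (contract g)
    ; nonempty = branch-nonempty
    ; connected = branch-connected v∈B
    ; edges = branch-edges
    }

deleteVertex⁺≼⁺ : (G : Graph) (B : VSet G) (v : Fin (n G)) → B v ≡ true →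
                  (m : ℕ) (e : n G ≡ suc m) →
                  (deleteVertex G m e v ⁺ boundaryAfterDelete G m e B v) ≼ (G ⁺ B)
deleteVertex⁺≼⁺ record { n = .(suc m) ; adj = a ; sym = s ; irrefl = i } B v v∈B m refl =
  ApexEdgeContraction.minor m a s i B v v∈B

lemma2 : (M : Graph → Set) → MinorClosed M →
         (G : Graph) → M G → (B : VSet G) → IsBoundary M G B →
         (v : Fin (n G)) → B v ≡ true →
         (m : ℕ) (e : n G ≡ suc m) →
         IsBoundary M (deleteVertex G m e v) (boundaryAfterDelete G m e B v)
lemma2 M minorClosed G _ B G⁺B∈M v v∈B m e =
  minorClosed (G ⁺ B) _ G⁺B∈M (deleteVertex⁺≼⁺ G B v v∈B m e)
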